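{- Let $\mathbf{A}$ be a distributive nearlattice and $F$ a filter of $A$. Then $\sigma(F)=\{x\in A\colon x^{\top}\veebar F=A\}$ is an $\alpha$-filter of $A$ and $\sigma(F)\subseteq F$.
   Context: A distributive nearlattice is a join-semilattice $\langle A,\vee,1\rangle$ with greatest element $1$ in which every principal filter $[a)=\{x\in A\colon a\le x\}$ is a bounded distributive lattice. A filter of $A$ is a subset containing $1$, upward closed, and closed under those binary meets that exist; for filters $F,G$, $F\veebar G$ is the smallest filter containing $F\cup G$. For $a\in A$, $a^{\top}=\{x\in A\colon x\vee a=1\}$ and $a^{\top\top}=\{y\in A\colon y\vee x=1\text{ for all }x\in a^{\top}\}$. A filter $F$ is an $\alpha$-filter if $a^{\top\top}\subseteq F$ for all $a\in F$. -}

module Defs where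

open import Level using (Level; _⊔_; suc; 0ℓ)
open import Data.Product using (Σ; _×_; _,_)
open import Relation.Binary.PropositionalEquality using (_≡_)
open import Relation.Unary using (Pred; _⊆_; _∈_)

-- A distributive nearlattice: a join-semilattice ⟨A, ∨, 1⟩ with greatest
-- element 1 in which every principal filter [a) is a bounded distributive
-- lattice.  Order: x ≤ y iff x ∨ y ≡ y.
record DistributiveNearlattice : Set₁ where
  infixr 6 _∨_
  infix 4 _≤_
  field
    Carrier : Set
    _∨_     : Carrier → Carrier → Carrier
    𝟏       : Carrier
    ∨-assoc : ∀ x y z → (x ∨ y) ∨ z ≡ x ∨ (y ∨ z)
    ∨-comm  : ∀ x y → x ∨ y ≡ y ∨ x
    ∨-idem  : ∀ x → x ∨ x ≡ x
    ∨-top   : ∀ x → x ∨ 𝟏 ≡ 𝟏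

  _≤_ : Carrier → Carrier → Set
  x ≤ y = x ∨ y ≡ y

  IsMeet : Carrier → Carrier → Carrier → Set
  IsMeet x y z = (z ≤ x) × (z ≤ y) × (∀ w → w ≤ x → w ≤ y → w ≤ z)

  field
    meet-exists : ∀ a x y → a ≤ x → a ≤ y → Σ Carrier (IsMeet x y)
    distrib : ∀ a x y z m₁ m₂ m₃ → a ≤ x → a ≤ y → a ≤ z →
              IsMeet x (y ∨ z) m₁ → IsMeet x y m₂ → IsMeet x z m₃ →
              m₁ ≡ m₂ ∨ m₃
  -- ([a) is bounded: a is its least element and 𝟏 its greatest.)

module _ (𝔸 : DistributiveNearlattice) where
  open DistributiveNearlattice 𝔸

  record IsFilter {ℓ : Level} (F : Pred Carrier ℓ) : Set ℓ where
    field
      has-top  : 𝟏 ∈ F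
      up-closed : ∀ {x y} → x ≤ y → x ∈ F → y ∈ F
      meet-closed : ∀ {x y z} → x ∈ F → y ∈ F → IsMeet x y z → z ∈ F

  _⊻_ : Pred Carrier 0ℓ → Pred Carrier 0ℓ → Pred Carrier (suc 0ℓ)
  (F ⊻ G) x = ∀ (H : Pred Carrier 0ℓ) → IsFilter H → F ⊆ H → G ⊆ H → x ∈ H

  _^⊤ : Carrier → Pred Carrier 0ℓ
  (a ^⊤) x = x ∨ a ≡ 𝟏

  _^⊤⊤ : Carrier → Pred Carrier 0ℓ
  (a ^⊤⊤) y = ∀ x → x ∈ (a ^⊤) → y ∨ x ≡ 𝟏

  IsAlphaFilter : {ℓ : Level} → Pred Carrier ℓ → Set ℓ
  IsAlphaFilter F = IsFilter F × (∀ a → a ∈ F → (a ^⊤⊤) ⊆ F)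

  σ : Pred Carrier 0ℓ → Pred Carrier (suc 0ℓ)
  σ F x = ∀ y → y ∈ ((x ^⊤) ⊻ F)

-- Everything rests on one consequence of distributivity: joining with a fixed
-- element t preserves existing meets, (a ∧ b) ∨ t = (a ∨ t) ∧ (b ∨ t).  Hence
-- for a filter H the set {u : u ∨ t ∈ H} is again a filter; it contains H and
-- t^⊤, so it contains t^⊤ ⊻ H.  Taking t = x ∈ σ(F) and H = F gives x ∨ x ∈ F,
-- i.e. σ(F) ⊆ F.  For meets, if s ∈ x^⊤ and t ∈ y^⊤ then s ∨ t ∈ (x ∧ y)^⊤;
-- so every filter H ⊇ (x ∧ y)^⊤ ∪ F has y^⊤ ∪ F inside {u : u ∨ t ∈ H}, and
-- y ∈ σ(F) puts t there, i.e. t ∈ H, whence x^⊤ ⊆ H and x ∈ σ(F) does the rest.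
-- Upward closure and the α-property hold because σ(F) is closed upwards along
-- the preorder x^⊤ ⊆ y^⊤.
module Submission where

open import Defs using (DistributiveNearlattice; IsFilter; IsAlphaFilter; σ)
open import Data.Product using (_×_; _,_; proj₁; proj₂)
open import Level using (0ℓ)
open import Relation.Unary using (Pred; _⊆_; _∈_)
open import Relation.Binary.PropositionalEquality
  using (_≡_; refl; sym; trans; cong; subst; module ≡-Reasoning)

module _ (𝔸 : DistributiveNearlattice) where
  open DistributiveNearlattice 𝔸

  infixl 5 _⊻_

  _⊻_ : Pred Carrier 0ℓ → Pred Carrier 0ℓ → Pred Carrier (Level.suc 0ℓ)
  _⊻_ = Defs._⊻_ 𝔸

  _^⊤ : Carrier → Pred Carrier 0ℓ
  _^⊤ = Defs._^⊤ 𝔸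

  _^⊤⊤ : Carrier → Pred Carrier 0ℓ
  _^⊤⊤ = Defs._^⊤⊤ 𝔸

  ≤-refl : ∀ x → x ≤ x
  ≤-refl = ∨-idem

  ≤-trans : ∀ {x y z} → x ≤ y → y ≤ z → x ≤ z
  ≤-trans {x} {y} {z} x≤y y≤z = begin
    x ∨ z        ≡⟨ cong (x ∨_) (sym y≤z) ⟩
    x ∨ (y ∨ z)  ≡⟨ sym (∨-assoc x y z) ⟩
    (x ∨ y) ∨ z  ≡⟨ cong (_∨ z) x≤y ⟩
    y ∨ z        ≡⟨ y≤z ⟩
    z            ∎
    where open ≡-Reasoning

  x≤x∨y : ∀ x y → x ≤ x ∨ y
  x≤x∨y x y = trans (sym (∨-assoc x x y)) (cong (_∨ y) (∨-idem x))

  y≤x∨y : ∀ x y → y ≤ x ∨ y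
  y≤x∨y x y = subst (y ≤_) (∨-comm y x) (x≤x∨y y x)

  ∨-least : ∀ {x y z} → x ≤ z → y ≤ z → x ∨ y ≤ z
  ∨-least {x} {y} {z} x≤z y≤z = trans (∨-assoc x y z) (trans (cong (x ∨_) y≤z) x≤z)

  ∨-monoˡ-≤ : ∀ {x y} t → x ≤ y → x ∨ t ≤ y ∨ t
  ∨-monoˡ-≤ {x} {y} t x≤y = ∨-least (≤-trans x≤y (x≤x∨y y t)) (y≤x∨y y t)

  ≡𝟏-upward : ∀ {x y} → x ≤ y → x ≡ 𝟏 → y ≡ 𝟏
  ≡𝟏-upward {x} {y} x≤y refl = trans (sym x≤y) (trans (∨-comm 𝟏 y) (∨-top y))

  absorb-below : ∀ {z b} x → z ≤ b → b ∨ (z ∨ x) ≡ b ∨ x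
  absorb-below {z} {b} x z≤b = trans (sym (∨-assoc b z x)) (cong (_∨ x) (trans (∨-comm b z) z≤b))

  IsMeet-comm : ∀ {x y m} → IsMeet x y m → IsMeet y x m
  IsMeet-comm (m≤x , m≤y , greatest) = m≤y , m≤x , λ w w≤y w≤x → greatest w w≤x w≤y

  IsMeet-≤ : ∀ {x y} → y ≤ x → IsMeet x y y
  IsMeet-≤ {x} {y} y≤x = y≤x , ≤-refl y , λ _ _ w≤y → w≤y

  IsMeet-cong : ∀ {x y x′ y′ m} → x ≡ x′ → y ≡ y′ → IsMeet x y m → IsMeet x′ y′ m
  IsMeet-cong refl refl m-meet = m-meet

  -- Computed inside [a ∧ b): with v = (a ∧ b) ∨ t, distributivity gives
  -- (a ∨ t) ∧ (b ∨ v) = ((a ∨ t) ∧ b) ∨ v and (a ∨ t) ∧ b = b ∧ (a ∨ v) = (a ∧ b) ∨ (b ∧ v).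
  ∨-distribʳ-IsMeet : ∀ {a b z t m} → IsMeet a b z → IsMeet (a ∨ t) (b ∨ t) m → m ≤ z ∨ t
  ∨-distribʳ-IsMeet {a} {b} {z} {t} {m} z-meet@(z≤a , z≤b , _) m-meet =
    subst (_≤ v) (sym m≡k∨v) (∨-least k≤v (≤-refl v))
    where
      v = z ∨ t
      z≤v = x≤x∨y z t
      z≤a∨t = ≤-trans z≤a (x≤x∨y a t)
      k-meet = proj₂ (meet-exists z (a ∨ t) b z≤a∨t z≤b)
      k = proj₁ (meet-exists z (a ∨ t) b z≤a∨t z≤b)
      m≡k∨v : m ≡ k ∨ v
      m≡k∨v = distrib z (a ∨ t) b v m k v z≤a∨t z≤b z≤v
        (IsMeet-cong refl (sym (absorb-below t z≤b)) m-meet) k-meet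
        (IsMeet-≤ (∨-least z≤a∨t (y≤x∨y a t)))
      n-meet = proj₂ (meet-exists z b v z≤b z≤v)
      n = proj₁ (meet-exists z b v z≤b z≤v)
      k≡z∨n : k ≡ z ∨ n
      k≡z∨n = distrib z b a v k z n z≤b z≤a z≤v
        (IsMeet-cong refl (sym (absorb-below t z≤a)) (IsMeet-comm k-meet))
        (IsMeet-comm z-meet) n-meet
      k≤v : k ≤ v
      k≤v = subst (_≤ v) (sym k≡z∨n) (∨-least z≤v (proj₁ (proj₂ n-meet)))

  _∶_ : Pred Carrier 0ℓ → Carrier → Pred Carrier 0ℓ
  (H ∶ t) u = H (u ∨ t)

  ∶-isFilter : ∀ {H} t → IsFilter 𝔸 H → IsFilter 𝔸 (H ∶ t)
  ∶-isFilter {H} t H-filter = record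
    { has-top     = subst H (sym (trans (∨-comm 𝟏 t) (∨-top t))) has-top
    ; up-closed   = λ x≤y → up-closed (∨-monoˡ-≤ t x≤y)
    ; meet-closed = closed
    }
    where
      open IsFilter H-filter
      closed : ∀ {x y z} → x ∨ t ∈ H → y ∨ t ∈ H → IsMeet x y z → z ∨ t ∈ H
      closed {x} {y} {z} x∨t∈H y∨t∈H z-meet@(z≤x , z≤y , _) =
        up-closed (∨-distribʳ-IsMeet z-meet m-meet) (meet-closed x∨t∈H y∨t∈H m-meet)
        where
          m-meet = proj₂ (meet-exists (z ∨ t) (x ∨ t) (y ∨ t) (∨-monoˡ-≤ t z≤x) (∨-monoˡ-≤ t z≤y))

  ⊻-least : ∀ {F G H} → IsFilter 𝔸 H → F ⊆ H → G ⊆ H → F ⊻ G ⊆ H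
  ⊻-least H-filter F⊆H G⊆H x∈F⊻G = x∈F⊻G _ H-filter F⊆H G⊆H

  ⊻-monoˡ : ∀ {F F′ G} → F ⊆ F′ → F ⊻ G ⊆ F′ ⊻ G
  ⊻-monoˡ F⊆F′ x∈F⊻G H H-filter F′⊆H G⊆H = x∈F⊻G H H-filter (λ x∈F → F′⊆H (F⊆F′ x∈F)) G⊆H

  ⊆-∶ : ∀ {H} t → IsFilter 𝔸 H → H ⊆ H ∶ t
  ⊆-∶ t H-filter {u} = IsFilter.up-closed H-filter (x≤x∨y u t)

  ^⊤⊆-∶ : ∀ {H} t → IsFilter 𝔸 H → t ^⊤ ⊆ H ∶ t
  ^⊤⊆-∶ {H} t H-filter u∨t≡𝟏 = subst H (sym u∨t≡𝟏) (IsFilter.has-top H-filter)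

  ∈-∶-self : ∀ H {t} → t ∈ H ∶ t → t ∈ H
  ∈-∶-self H {t} = subst H (∨-idem t)

  ^⊤-anti : ∀ {x y} → x ≤ y → (x ^⊤) ⊆ (y ^⊤)
  ^⊤-anti {x} {y} x≤y {t} = ≡𝟏-upward (∨-least (x≤x∨y t y) (≤-trans x≤y (y≤x∨y t y)))

  ∨-∈-^⊤-IsMeet : ∀ {x y z s t} → IsMeet x y z → s ∈ x ^⊤ → t ∈ y ^⊤ → s ∨ t ∈ z ^⊤
  ∨-∈-^⊤-IsMeet {x} {y} {z} {s} {t} z-meet s∨x≡𝟏 t∨y≡𝟏 =
    trans (∨-comm (s ∨ t) z)
      (≡𝟏-upward (∨-distribʳ-IsMeet z-meet (IsMeet-cong (sym x∨s∨t≡𝟏) (sym y∨s∨t≡𝟏) (IsMeet-≤ (∨-idem 𝟏)))) refl)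
    where
      x∨s∨t≡𝟏 : x ∨ (s ∨ t) ≡ 𝟏
      x∨s∨t≡𝟏 = ≡𝟏-upward (∨-least (≤-trans (x≤x∨y s t) (y≤x∨y x (s ∨ t))) (x≤x∨y x (s ∨ t))) s∨x≡𝟏
      y∨s∨t≡𝟏 : y ∨ (s ∨ t) ≡ 𝟏
      y∨s∨t≡𝟏 = ≡𝟏-upward (∨-least (≤-trans (y≤x∨y s t) (y≤x∨y y (s ∨ t))) (x≤x∨y y (s ∨ t))) t∨y≡𝟏

  σ-upward : ∀ {F x y} → x ^⊤ ⊆ y ^⊤ → x ∈ σ 𝔸 F → y ∈ σ 𝔸 F
  σ-upward x^⊤⊆y^⊤ x∈σF w = ⊻-monoˡ x^⊤⊆y^⊤ (x∈σF w)

  σ-⊆ : ∀ {F} → IsFilter 𝔸 F → σ 𝔸 F ⊆ F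
  σ-⊆ {F} F-filter {x} x∈σF =
    ∈-∶-self F (⊻-least (∶-isFilter x F-filter) (^⊤⊆-∶ x F-filter) (⊆-∶ x F-filter) (x∈σF x))

  σ-meet-closed : ∀ {F x y z} → x ∈ σ 𝔸 F → y ∈ σ 𝔸 F → IsMeet x y z → z ∈ σ 𝔸 F
  σ-meet-closed {x = x} x∈σF y∈σF z-meet w H H-filter z^⊤⊆H F⊆H = x∈σF w H H-filter x^⊤⊆H F⊆H
    where
      x^⊤⊆H : x ^⊤ ⊆ H
      x^⊤⊆H {t} t∈x^⊤ = ∈-∶-self H (y∈σF t (H ∶ t) (∶-isFilter t H-filter)
        (λ s∈y^⊤ → z^⊤⊆H (∨-∈-^⊤-IsMeet (IsMeet-comm z-meet) s∈y^⊤ t∈x^⊤))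
        (λ u∈F → ⊆-∶ t H-filter (F⊆H u∈F)))

  σ-isFilter : ∀ {F} → IsFilter 𝔸 (σ 𝔸 F)
  σ-isFilter = record
    { has-top     = λ w H _ 𝟏^⊤⊆H _ → 𝟏^⊤⊆H (∨-top w)
    ; up-closed   = λ x≤y → σ-upward (^⊤-anti x≤y)
    ; meet-closed = σ-meet-closed
    }

  σ-⊇-^⊤⊤ : ∀ {F a} → a ∈ σ 𝔸 F → a ^⊤⊤ ⊆ σ 𝔸 F
  σ-⊇-^⊤⊤ a∈σF {w} w∈a^⊤⊤ = σ-upward (λ {t} t∈a^⊤ → trans (∨-comm t w) (w∈a^⊤⊤ t t∈a^⊤)) a∈σF

lemma4p11 : (𝔸 : DistributiveNearlattice) →
    (F : Pred (DistributiveNearlattice.Carrier 𝔸) 0ℓ) → IsFilter 𝔸 F →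
    IsAlphaFilter 𝔸 (σ 𝔸 F) × (σ 𝔸 F ⊆ F)
lemma4p11 𝔸 F F-filter = (σ-isFilter 𝔸 , λ a → σ-⊇-^⊤⊤ 𝔸) , σ-⊆ 𝔸 F-filter
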